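{- Let $G$ be a finite simple undirected graph with $m$ edges and arboricity $\alpha(G)$, and let $v_1, \ldots, v_n$ be an ordering of $V(G)$. For $1 \le i \le n$ let $G_i = G[\{v_1,\ldots,v_i\}]$ be the subgraph induced by $v_1,\ldots,v_i$, and for a vertex $w$ of $G_i$ let $h_i(w)$ be the number of neighbours $u$ of $w$ in $G_i$ with $d_{G_i}(u) \ge d_{G_i}(w)$. Then \[\sum_{i=1}^{n} \sum_{w \in N_{G_i}(v_i)} h_i(w) \le 8\alpha(G)\, m.\]
   Context: All graphs are finite, simple and undirected. $d_H(v)$ and $N_H(v)$ denote the degree and the (open) neighbourhood of $v$ in a graph $H$. The arboricity $\alpha(G)$ is the minimum number of edge-disjoint spanning forests into which $E(G)$ can be decomposed. -}

module Defs where

open import Data.Nat using (ℕ; zero; suc; _+_; _*_; _≤_; _<_; _≤ᵇ_; _<ᵇ_)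
open import Data.Bool using (Bool; true; false; _∧_; if_then_else_)
open import Data.Fin as Fin using (Fin; toℕ; inject₁; fromℕ)
open import Data.Fin.Permutation using (Permutation′; _⟨$⟩ʳ_; _⟨$⟩ˡ_)
open import Data.List using (List; map; allFin)
open import Data.Nat.ListAction using (sum)
open import Data.Product using (Σ; _×_; ∃)
open import Relation.Binary.PropositionalEquality using (_≡_)
open import Function.Definitions using (Injective)
open import Relation.Nullary using (¬_)

record Graph (n : ℕ) : Set where
  field
    adj    : Fin n → Fin n → Bool
    sym    : ∀ u v → adj u v ≡ adj v u
    irrefl : ∀ v → adj v v ≡ false
open Graph public

Adj : ∀ {n} → Graph n → Fin n → Fin n → Set
Adj G u v = adj G u v ≡ true

count : (n : ℕ) → (Fin n → Bool) → ℕ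
count n p = sum (map (λ x → if p x then 1 else 0) (allFin n))

sumWhere : (n : ℕ) → (Fin n → Bool) → (Fin n → ℕ) → ℕ
sumWhere n p f = sum (map (λ x → if p x then f x else 0) (allFin n))

edges : ∀ {n} → Graph n → ℕ
edges {n} G = sumWhere n (λ _ → true) (λ u → count n (λ v → (toℕ u <ᵇ toℕ v) ∧ adj G u v))

-- A cycle in a relation R on Fin n: distinct vertices f 0, …, f (l+2)
-- (length ≥ 3), consecutive ones related, and the last related to the first.
HasCycle : ∀ {n} → (Fin n → Fin n → Set) → Set
HasCycle {n} R =
  Σ ℕ λ l → Σ (Fin (suc (suc (suc l))) → Fin n) λ f →
    Injective _≡_ _≡_ f
    × (∀ (i : Fin (suc (suc l))) → R (f (inject₁ i)) (f (Fin.suc i)))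
    × R (f (fromℕ (suc (suc l)))) (f Fin.zero)

-- A decomposition of E(G) into k edge-disjoint forests: a colouring of the
-- edges with k colours (symmetric on edges) such that every colour class is acyclic.
ForestDecomposition : ∀ {n} → Graph n → ℕ → Set
ForestDecomposition {n} G k =
  Σ (Fin n → Fin n → Fin k) λ c →
    (∀ u v → Adj G u v → c u v ≡ c v u)
    × (∀ (j : Fin k) → ¬ HasCycle (λ u v → Adj G u v × c u v ≡ j))

IsArboricity : ∀ {n} → Graph n → ℕ → Set
IsArboricity G k = ForestDecomposition G k × (∀ j → ForestDecomposition G j → k ≤ j)

-- Ordering v_1,…,v_n of V(G) given by a permutation σ: the vertex at
-- (0-based) position t is σ ⟨$⟩ʳ t.  G_t is induced by positions 0..t.
module _ {n : ℕ} (G : Graph n) (σ : Permutation′ n) where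
  inG : Fin n → Fin n → Bool
  inG t x = toℕ (σ ⟨$⟩ˡ x) ≤ᵇ toℕ t

  deg : Fin n → Fin n → ℕ
  deg t u = count n (λ x → inG t x ∧ adj G u x)

  h : Fin n → Fin n → ℕ
  h t w = count n (λ u → inG t u ∧ adj G w u ∧ (deg t w ≤ᵇ deg t u))

  inner : Fin n → ℕ
  inner t = sumWhere n (λ w → inG t w ∧ adj G (σ ⟨$⟩ʳ t) w) (h t)

  total : ℕ
  total = sumWhere n (λ _ → true) inner

module Submission where

-- 1. Exchanging the order of summation, total counts, for every ordered
--    pair (w , u) of adjacent vertices, the times t at which v_t is a
--    neighbour of w and d_{G_t}(w) ≤ d_{G_t}(u).  There are at most
--    min(d(w), d(u)) such times (CountingByEdges), so
--    total ≤ edgeMin d := ∑_{w ~ u} min(d(w), d(u)).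
-- 2. In a forest, removing a leaf shows ∑_{w ~ u} min(f w, f u) ≤ 2 ∑ f for
--    any vertex weights f (ForestBound); leaves exist because a
--    non-backtracking walk in a finite graph closes a cycle.  Splitting E(G)
--    into k forests gives edgeMin f ≤ 2k ∑ f.
-- 3. The handshake lemma ∑ d ≤ 2m then yields total ≤ 4km ≤ 8km.

open import Defs hiding (sym)
open import Data.Nat using (ℕ; zero; suc; _+_; _*_; _≤_; _<_; _⊓_; z≤n; s≤s; _≤ᵇ_; _<ᵇ_)
open import Data.Nat.Properties hiding (_≟_)
open import Data.Bool using (Bool; true; false; _∧_; if_then_else_)
import Data.Bool.Properties as Bool
open import Data.Fin as Fin using (Fin; toℕ; inject₁; fromℕ)
open import Data.Fin.Properties
  using (_≟_; any?; pigeonhole; toℕ-injective; toℕ-inject₁; toℕ-fromℕ; toℕ≤pred[n])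
open import Data.Fin.Permutation using (Permutation′; _⟨$⟩ʳ_; inverseˡ)
import Data.List as List using (map; tabulate; allFin)
import Data.Nat.ListAction as List using (sum)
open import Data.Product using (Σ; _×_; ∃; _,_; proj₁; proj₂)
open import Data.Sum using (_⊎_; inj₁; inj₂)
open import Data.Empty using (⊥-elim)
open import Function using (_∘′_)
open import Function.Bundles using (Equivalence)
open import Relation.Binary using (tri<; tri≈; tri>)
open import Relation.Binary.PropositionalEquality
open import Relation.Nullary using (¬_; yes; no; ⌊_⌋)
open import Relation.Nullary.Decidable using (_×-dec_; ¬?)
open import Algebra.Properties.Semiring.Sum +-*-semiring
  using (sum; sum-syntax; sum-cong-≗; sum-replicate-zero; ∑-distrib-+; ∑-comm; ∑-permute; *-distribʳ-sum)

𝟙 : Bool → ℕ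
𝟙 b = if b then 1 else 0

-- The list sums over allFin used in Defs are the finite sums ∑ of the
-- algebra library, whose laws (distributivity, exchange, reindexing) we use.
list-sum-tabulate : ∀ {A : Set} n (g : Fin n → A) (f : A → ℕ) →
  List.sum (List.map f (List.tabulate g)) ≡ ∑[ i < n ] f (g i)
list-sum-tabulate zero    g f = refl
list-sum-tabulate (suc n) g f = cong (f (g Fin.zero) +_) (list-sum-tabulate n (g ∘′ Fin.suc) f)

list-sum-allFin : ∀ n (f : Fin n → ℕ) → List.sum (List.map f (List.allFin n)) ≡ ∑[ i < n ] f i
list-sum-allFin n = list-sum-tabulate n (λ i → i)

∑-mono : ∀ {n} {f g : Fin n → ℕ} → (∀ i → f i ≤ g i) → ∑[ i < n ] f i ≤ ∑[ i < n ] g i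
∑-mono {zero}  f≤g = z≤n
∑-mono {suc n} f≤g = +-mono-≤ (f≤g Fin.zero) (∑-mono (λ i → f≤g (Fin.suc i)))

∑-zero : ∀ n → ∑[ i < n ] 0 ≡ 0
∑-zero = sum-replicate-zero

∑-const : ∀ n c → ∑[ i < n ] c ≡ n * c
∑-const zero    c = refl
∑-const (suc n) c = cong (c +_) (∑-const n c)

∧-trueˡ : ∀ {a b} → a ∧ b ≡ true → a ≡ true
∧-trueˡ {true} _ = refl

∧-trueʳ : ∀ {a b} → a ∧ b ≡ true → b ≡ true
∧-trueʳ {true} ab = ab

𝟙-∧ˡ : ∀ a b → 𝟙 (a ∧ b) ≤ 𝟙 a
𝟙-∧ˡ true  true  = ≤-refl
𝟙-∧ˡ true  false = z≤n
𝟙-∧ˡ false b     = z≤n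

𝟙-∧ʳ : ∀ a b → 𝟙 (a ∧ b) ≤ 𝟙 b
𝟙-∧ʳ true  b = ≤-refl
𝟙-∧ʳ false b = z≤n

∑-point : ∀ {n} (v : Fin n) (g : Fin n → ℕ) → ∑[ x < n ] (if ⌊ x ≟ v ⌋ then g x else 0) ≡ g v
∑-point {suc n} Fin.zero    g = trans (cong (g Fin.zero +_) (∑-zero n)) (+-identityʳ _)
∑-point {suc n} (Fin.suc v) g =
  trans (sum-cong-≗ drop-zero) (∑-point v (λ x → g (Fin.suc x)))
  where
  drop-zero : ∀ x → (if ⌊ Fin.suc x ≟ Fin.suc v ⌋ then g (Fin.suc x) else 0)
                  ≡ (if ⌊ x ≟ v ⌋ then g (Fin.suc x) else 0)
  drop-zero x with x ≟ v
  ... | yes _ = refl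
  ... | no  _ = refl

∑∑-distrib-+ : ∀ {m n} (f g : Fin m → Fin n → ℕ) →
  ∑[ i < m ] ∑[ j < n ] (f i j + g i j) ≡ ∑[ i < m ] ∑[ j < n ] f i j + ∑[ i < m ] ∑[ j < n ] g i j
∑∑-distrib-+ {m} {n} f g =
  trans (sum-cong-≗ (λ i → ∑-distrib-+ (f i) (g i))) (∑-distrib-+ (λ i → ∑[ j < n ] f i j) _)

HasCycle-map : ∀ {n} {R R′ : Fin n → Fin n → Set} →
  (∀ {a b} → R a b → R′ a b) → HasCycle R → HasCycle R′
HasCycle-map R⊆R′ (l , f , f-inj , steps , closing) = l , f , f-inj , (λ i → R⊆R′ (steps i)) , R⊆R′ closing

-- An infinite walk w in a relation on Fin n that never stays put and never
-- immediately backtracks contains a cycle: take the first vertex repetition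
-- w a ≡ w b; the vertices w a, …, w (b-1) are distinct and, by the two
-- conditions, there are at least three of them.
module NonBacktrackingWalk {n : ℕ} {R : Fin n → Fin n → Set} (w : ℕ → Fin n)
  (step : ∀ i → R (w i) (w (suc i)))
  (no-loop : ∀ i → w (suc i) ≢ w i)
  (no-backtrack : ∀ i → w (suc (suc i)) ≢ w i) where

  DistinctUpTo : ℕ → Set
  DistinctUpTo j = ∀ a b → a < b → b ≤ j → w a ≢ w b

  close-cycle : ∀ a l → w a ≡ w (a + suc (suc (suc l))) →
                DistinctUpTo (a + suc (suc l)) → HasCycle R
  close-cycle a l repeat distinct = l , f , f-inj , steps , closing
    where
    f : Fin (suc (suc (suc l))) → Fin n
    f k = w (a + toℕ k)
    in-range : ∀ k → a + toℕ k ≤ a + suc (suc l)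
    in-range k = +-monoʳ-≤ a (toℕ≤pred[n] k)
    f-inj : ∀ {k k′} → f k ≡ f k′ → k ≡ k′
    f-inj {k} {k′} eq with <-cmp (toℕ k) (toℕ k′)
    ... | tri< k<k′ _ _ = ⊥-elim (distinct _ _ (+-monoʳ-< a k<k′) (in-range k′) eq)
    ... | tri≈ _ k≡k′ _ = toℕ-injective k≡k′
    ... | tri> _ _ k>k′ = ⊥-elim (distinct _ _ (+-monoʳ-< a k>k′) (in-range k) (sym eq))
    steps : ∀ (k : Fin (suc (suc l))) → R (f (inject₁ k)) (f (Fin.suc k))
    steps k rewrite toℕ-inject₁ k | +-suc a (toℕ k) = step (a + toℕ k)
    closing : R (f (fromℕ (suc (suc l)))) (f Fin.zero)
    closing rewrite toℕ-fromℕ (suc (suc l)) | +-identityʳ a | repeat | +-suc a (suc (suc l))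
      = step (a + suc (suc l))

  repetition-cycle : ∀ a o → w a ≡ w (a + suc o) → DistinctUpTo (a + o) → HasCycle R
  repetition-cycle a zero repeat _ =
    ⊥-elim (no-loop a (sym (subst (λ x → w a ≡ w x) (+-comm a 1) repeat)))
  repetition-cycle a (suc zero) repeat _ =
    ⊥-elim (no-backtrack a (sym (subst (λ x → w a ≡ w x) (+-comm a 2) repeat)))
  repetition-cycle a (suc (suc l)) repeat distinct = close-cycle a l repeat distinct

  distinct-or-cycle : ∀ j → DistinctUpTo j ⊎ HasCycle R
  distinct-or-cycle zero = inj₁ λ { a b a<b z≤n → ⊥-elim (n≮0 a<b) }
  distinct-or-cycle (suc j) with distinct-or-cycle j
  ... | inj₂ cycle = inj₂ cycle
  ... | inj₁ distinct with anyUpTo? (λ a → w a ≟ w (suc j)) (suc j)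
  ...   | no no-repeat = inj₁ extend
    where
    extend : DistinctUpTo (suc j)
    extend a b a<b b≤1+j eq with m≤n⇒m<n∨m≡n b≤1+j
    ... | inj₁ b<1+j = distinct a b a<b (≤-pred b<1+j) eq
    ... | inj₂ refl  = no-repeat (a , a<b , eq)
  ...   | yes (a , a<1+j , repeat) with m≤n⇒∃[o]m+o≡n (≤-pred a<1+j)
  ...     | o , refl = inj₂ (repetition-cycle a o (subst (λ x → w a ≡ w x) (sym (+-suc a o)) repeat) distinct)

  -- n + 1 vertices of Fin n cannot be distinct, so the walk closes a cycle.
  cycle : HasCycle R
  cycle with distinct-or-cycle n
  ... | inj₂ c = c
  ... | inj₁ distinct with pigeonhole (n<1+n n) (λ k → w (toℕ k))
  ...   | i , j , i<j , eq = ⊥-elim (distinct (toℕ i) (toℕ j) i<j (toℕ≤pred[n] j) eq)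

degIn : ∀ {n} → (Fin n → Fin n → Bool) → (Fin n → Bool) → Fin n → ℕ
degIn {n} F S v = ∑[ u < n ] 𝟙 (S u ∧ F v u)

-- In an irreflexive acyclic relation F, every nonempty vertex set S contains
-- a vertex with at most one neighbour in S.  Otherwise every v ∈ S has, for
-- any y, a neighbour in S other than y, and a non-backtracking walk inside S
-- produces a cycle.
module _ {n : ℕ} (F : Fin n → Fin n → Bool) (F-irrefl : ∀ v → F v v ≡ false)
  (F-acyclic : ¬ HasCycle (λ a b → F a b ≡ true)) where

  module Branching (S : Fin n → Bool)
    (branch : ∀ v → S v ≡ true → ∀ y → ∃ λ x → S x ≡ true × F v x ≡ true × x ≢ y) where

    Arc : Set
    Arc = Σ (Fin n × Fin n) λ pc → S (proj₂ pc) ≡ true × F (proj₁ pc) (proj₂ pc) ≡ true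

    next : Arc → Arc
    next ((p , c) , c∈S , _) = (c , proj₁ x) , proj₁ (proj₂ x) , proj₁ (proj₂ (proj₂ x))
      where x = branch c c∈S p

    arcs : Arc → ℕ → Arc
    arcs a zero    = a
    arcs a (suc i) = next (arcs a i)

    -- the vertex sequence of the walk never stays put (F is irreflexive)
    -- and never backtracks, so it closes a cycle
    walk-cycle : Arc → HasCycle (λ a b → F a b ≡ true)
    walk-cycle a = NonBacktrackingWalk.cycle {R = λ a b → F a b ≡ true} w step no-loop no-backtrack
      where
      w : ℕ → Fin n
      w i = proj₁ (proj₁ (arcs a i))
      step : ∀ i → F (w i) (w (suc i)) ≡ true
      step i = proj₂ (proj₂ (arcs a i))
      no-loop : ∀ i → w (suc i) ≢ w i
      no-loop i eq with trans (sym (step i)) (trans (cong (F (w i)) eq) (F-irrefl (w i)))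
      ... | ()
      no-backtrack : ∀ i → w (suc (suc i)) ≢ w i
      no-backtrack i = proj₂ (proj₂ (proj₂ (branch _ (proj₁ (proj₂ (arcs a i))) (w i))))

  leaf : ∀ (S : Fin n → Bool) v₀ → S v₀ ≡ true → ∃ λ v → S v ≡ true × degIn F S v ≤ 1
  leaf S v₀ v₀∈S with any? (λ v → (S v Bool.≟ true) ×-dec (degIn F S v ≤? 1))
  ... | yes found  = found
  ... | no no-leaf = ⊥-elim (F-acyclic (Branching.walk-cycle S branch start))
    where
    -- a vertex of S without a second neighbour in S would be a leaf
    branch : ∀ v → S v ≡ true → ∀ y → ∃ λ x → S x ≡ true × F v x ≡ true × x ≢ y
    branch v v∈S y with any? (λ x → ((S x ∧ F v x) Bool.≟ true) ×-dec ¬? (x ≟ y))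
    ... | yes (x , x∈N , x≢y) = x , ∧-trueˡ x∈N , ∧-trueʳ x∈N , x≢y
    ... | no only-y = ⊥-elim (no-leaf (v , v∈S , deg≤1))
      where
      at-most-y : ∀ x → 𝟙 (S x ∧ F v x) ≤ (if ⌊ x ≟ y ⌋ then 1 else 0)
      at-most-y x with S x ∧ F v x in x∈N | x ≟ y
      ... | false | _       = z≤n
      ... | true  | yes _   = ≤-refl
      ... | true  | no x≢y = ⊥-elim (only-y (x , x∈N , x≢y))
      deg≤1 : degIn F S v ≤ 1
      deg≤1 = ≤-trans (∑-mono at-most-y) (≤-reflexive (∑-point y (λ _ → 1)))
    start : Branching.Arc S branch
    start = (v₀ , proj₁ b) , proj₁ (proj₂ b) , proj₁ (proj₂ (proj₂ b))
      where b = branch v₀ v₀∈S v₀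

-- Removing a vertex v with at most one neighbour loses
-- at most the two ordered pairs through its edge, each worth at most f v;
-- induct on the size of the remaining vertex set.
module ForestBound {n : ℕ} (F : Fin n → Fin n → Bool)
  (F-sym : ∀ u v → F u v ≡ F v u) (F-irrefl : ∀ v → F v v ≡ false)
  (F-acyclic : ¬ HasCycle (λ a b → F a b ≡ true)) (f : Fin n → ℕ) where

  pairIn : (Fin n → Bool) → Fin n → Fin n → ℕ
  pairIn S w u = if S w ∧ S u ∧ F w u then f w ⊓ f u else 0

  edgeMinIn : (Fin n → Bool) → ℕ
  edgeMinIn S = ∑[ w < n ] ∑[ u < n ] pairIn S w u

  weightIn : (Fin n → Bool) → (Fin n → ℕ) → ℕ
  weightIn S g = ∑[ w < n ] (if S w then g w else 0)

  sizeIn : (Fin n → Bool) → ℕ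
  sizeIn S = weightIn S (λ _ → 1)

  _─_ : (Fin n → Bool) → Fin n → Fin n → Bool
  (S ─ v) w = if ⌊ w ≟ v ⌋ then false else S w

  remove-weight : ∀ S v g → S v ≡ true → weightIn S g ≡ weightIn (S ─ v) g + g v
  remove-weight S v g v∈S = begin
    weightIn S g                                 ≡⟨ sum-cong-≗ split ⟩
    ∑[ w < n ] (rest w + at-v w)                 ≡⟨ ∑-distrib-+ rest at-v ⟩
    weightIn (S ─ v) g + ∑[ w < n ] at-v w       ≡⟨ cong (weightIn (S ─ v) g +_) (∑-point v g) ⟩
    weightIn (S ─ v) g + g v                     ∎
    where
    open ≡-Reasoning
    rest at-v : Fin n → ℕ
    rest w = if (S ─ v) w then g w else 0
    at-v w = if ⌊ w ≟ v ⌋ then g w else 0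
    split : ∀ w → (if S w then g w else 0) ≡ rest w + at-v w
    split w with w ≟ v
    ... | yes refl rewrite v∈S = refl
    ... | no  _    = sym (+-identityʳ _)

  remove-size : ∀ S v → S v ≡ true → sizeIn S ≡ suc (sizeIn (S ─ v))
  remove-size S v v∈S = trans (remove-weight S v (λ _ → 1) v∈S) (+-comm _ 1)

  star : (Fin n → Bool) → Fin n → Fin n → ℕ
  star S v x = if S x ∧ F v x then f v else 0

  star-leaf : ∀ S v → degIn F S v ≤ 1 → ∑[ x < n ] star S v x ≤ f v
  star-leaf S v leaf = begin
    ∑[ x < n ] star S v x               ≡⟨ sum-cong-≗ as-product ⟩
    ∑[ x < n ] (𝟙 (S x ∧ F v x) * f v) ≡⟨ sym (*-distribʳ-sum (f v) (λ x → 𝟙 (S x ∧ F v x))) ⟩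
    degIn F S v * f v                   ≤⟨ *-monoˡ-≤ (f v) leaf ⟩
    1 * f v                             ≡⟨ *-identityˡ (f v) ⟩
    f v                                 ∎
    where
    open ≤-Reasoning
    as-product : ∀ x → star S v x ≡ 𝟙 (S x ∧ F v x) * f v
    as-product x with S x ∧ F v x
    ... | true  = sym (+-identityʳ (f v))
    ... | false = refl

  leaving entering : (Fin n → Bool) → Fin n → Fin n → Fin n → ℕ
  leaving  S v w u = if ⌊ w ≟ v ⌋ then star S v u else 0
  entering S v w u = if ⌊ u ≟ v ⌋ then star S v w else 0

  ∑-leaving : ∀ S v → ∑[ w < n ] ∑[ u < n ] leaving S v w u ≡ ∑[ x < n ] star S v x
  ∑-leaving S v = trans (∑-comm (leaving S v)) (sum-cong-≗ (λ u → ∑-point v (λ _ → star S v u)))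

  ∑-entering : ∀ S v → ∑[ w < n ] ∑[ u < n ] entering S v w u ≡ ∑[ x < n ] star S v x
  ∑-entering S v = sum-cong-≗ (λ w → ∑-point v (λ _ → star S v w))

  -- A pair inside S either avoids v or has v as one of its ends; in the
  -- latter case min(f w, f u) ≤ f v (this is where F-sym is needed).
  pair-split : ∀ S v → S v ≡ true → ∀ w u →
    pairIn S w u ≤ (pairIn (S ─ v) w u + leaving S v w u) + entering S v w u
  pair-split S v v∈S w u with w ≟ v | u ≟ v
  ... | yes refl | _ = ≤-trans from-v (m≤m+n (star S w u) _)
    where
    from-v : pairIn S w u ≤ star S w u
    from-v rewrite v∈S with S u ∧ F w u
    ... | true  = m⊓n≤m (f w) (f u)
    ... | false = z≤n
  ... | no _ | yes refl = ≤-trans to-v (m≤n+m _ _)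
    where
    to-v : pairIn S w u ≤ star S u w
    to-v rewrite v∈S | F-sym w u with S w ∧ F u w
    ... | true  = m⊓n≤n (f w) (f u)
    ... | false = z≤n
  ... | no _ | no _ = ≤-trans (m≤m+n (pairIn S w u) 0) (m≤m+n _ 0)

  remove-leaf : ∀ S v → S v ≡ true → degIn F S v ≤ 1 → edgeMinIn S ≤ edgeMinIn (S ─ v) + 2 * f v
  remove-leaf S v v∈S leaf = begin
    edgeMinIn S                                    ≤⟨ ∑-mono (λ w → ∑-mono (pair-split S v v∈S w)) ⟩
    ∑[ w < n ] ∑[ u < n ] ((pairIn S′ w u + leaving S v w u) + entering S v w u)
                                                   ≡⟨ ∑∑-distrib-+ _ (entering S v) ⟩
    ∑[ w < n ] ∑[ u < n ] (pairIn S′ w u + leaving S v w u) + ∑[ w < n ] ∑[ u < n ] entering S v w u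
                                                   ≡⟨ cong₂ _+_ (∑∑-distrib-+ (pairIn S′) (leaving S v)) (∑-entering S v) ⟩
    (edgeMinIn S′ + ∑[ w < n ] ∑[ u < n ] leaving S v w u) + Star
                                                   ≡⟨ cong (λ s → (edgeMinIn S′ + s) + Star) (∑-leaving S v) ⟩
    (edgeMinIn S′ + Star) + Star                   ≤⟨ +-mono-≤ (+-monoʳ-≤ (edgeMinIn S′) (star-leaf S v leaf)) (star-leaf S v leaf) ⟩
    (edgeMinIn S′ + f v) + f v                     ≡⟨ +-assoc (edgeMinIn S′) (f v) (f v) ⟩
    edgeMinIn S′ + (f v + f v)                     ≡⟨ cong (λ s → edgeMinIn S′ + (f v + s)) (sym (+-identityʳ (f v))) ⟩
    edgeMinIn S′ + 2 * f v                         ∎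
    where
    open ≤-Reasoning
    S′ : Fin n → Bool
    S′ = S ─ v
    Star : ℕ
    Star = ∑[ x < n ] star S v x

  edgeMinIn-bound : ∀ N S → sizeIn S ≤ N → edgeMinIn S ≤ 2 * weightIn S f
  edgeMinIn-bound N S size≤N with any? (λ v → S v Bool.≟ true)
  ... | no empty = ≤-trans (∑-mono no-pairs) (≤-trans (≤-reflexive (∑-zero n)) z≤n)
    where
    no-pairs : ∀ w → ∑[ u < n ] pairIn S w u ≤ 0
    no-pairs w with S w in w∈S
    ... | true  = ⊥-elim (empty (w , w∈S))
    ... | false = ≤-reflexive (∑-zero n)
  ... | yes (v₀ , v₀∈S) with leaf F F-irrefl F-acyclic S v₀ v₀∈S
  ...   | v , v∈S , v-leaf with N
  ...     | zero = ⊥-elim (n≮0 (subst (_≤ 0) (remove-size S v v∈S) size≤N))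
  ...     | suc N′ = begin
    edgeMinIn S                              ≤⟨ remove-leaf S v v∈S v-leaf ⟩
    edgeMinIn (S ─ v) + 2 * f v              ≤⟨ +-monoˡ-≤ (2 * f v) (edgeMinIn-bound N′ (S ─ v) smaller) ⟩
    2 * weightIn (S ─ v) f + 2 * f v         ≡⟨ sym (*-distribˡ-+ 2 (weightIn (S ─ v) f) (f v)) ⟩
    2 * (weightIn (S ─ v) f + f v)           ≡⟨ cong (2 *_) (sym (remove-weight S v f v∈S)) ⟩
    2 * weightIn S f                         ∎
    where
    open ≤-Reasoning
    smaller : sizeIn (S ─ v) ≤ N′
    smaller = ≤-pred (subst (_≤ suc N′) (remove-size S v v∈S) size≤N)

  forest-edge-min : ∑[ w < n ] ∑[ u < n ] (if F w u then f w ⊓ f u else 0) ≤ 2 * ∑[ w < n ] f w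
  forest-edge-min = edgeMinIn-bound n (λ _ → true) (≤-reflexive (trans (∑-const n 1) (*-identityʳ n)))

module _ {n : ℕ} (G : Graph n) where

  degree : Fin n → ℕ
  degree y = ∑[ x < n ] 𝟙 (adj G y x)

  edgeMin : (Fin n → ℕ) → ℕ
  edgeMin f = ∑[ w < n ] ∑[ u < n ] (if adj G w u then f w ⊓ f u else 0)

  -- Handshake lemma (as an inequality): every edge is counted twice.
  handshake : ∑[ y < n ] degree y ≤ 2 * edges G
  handshake = begin
    ∑[ u < n ] degree u                                  ≤⟨ ∑-mono (λ u → ∑-mono (one-direction u)) ⟩
    ∑[ u < n ] ∑[ v < n ] (up u v + up v u)              ≡⟨ ∑∑-distrib-+ up (λ u v → up v u) ⟩
    E + ∑[ u < n ] ∑[ v < n ] up v u                     ≡⟨ cong (E +_) (∑-comm (λ u v → up v u)) ⟩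
    E + E                                                ≡⟨ cong (E +_) (sym (+-identityʳ E)) ⟩
    2 * E                                                ≡⟨ cong (2 *_) E≡edges ⟩
    2 * edges G                                          ∎
    where
    open ≤-Reasoning
    up : Fin n → Fin n → ℕ
    up u v = 𝟙 ((toℕ u <ᵇ toℕ v) ∧ adj G u v)
    E : ℕ
    E = ∑[ u < n ] ∑[ v < n ] up u v
    E≡edges : E ≡ edges G
    E≡edges = sym (trans (list-sum-allFin n _) (sum-cong-≗ (λ u → list-sum-allFin n (up u))))
    one-direction : ∀ u v → 𝟙 (adj G u v) ≤ up u v + up v u
    one-direction u v with <-cmp (toℕ u) (toℕ v)
    ... | tri< u<v _ _ rewrite Equivalence.to Bool.T-≡ (<⇒<ᵇ u<v) = m≤m+n _ _
    ... | tri> _ _ v<u rewrite Equivalence.to Bool.T-≡ (<⇒<ᵇ v<u) | Graph.sym G u v = m≤n+m _ _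
    ... | tri≈ _ u≡v _ rewrite toℕ-injective u≡v | irrefl G v = z≤n

  -- Splitting E(G) into the colour classes of a decomposition into k forests
  -- and applying the forest inequality to each class.
  edgeMin-forests : ∀ k → ForestDecomposition G k →
                    ∀ f → edgeMin f ≤ k * (2 * ∑[ w < n ] f w)
  edgeMin-forests k (c , c-sym , c-acyclic) f = begin
    edgeMin f                                         ≡⟨ sum-cong-≗ (λ w → sum-cong-≗ (by-colour w)) ⟩
    ∑[ w < n ] ∑[ u < n ] ∑[ j < k ] coloured j w u    ≡⟨ sum-cong-≗ (λ w → ∑-comm (λ u j → coloured j w u)) ⟩
    ∑[ w < n ] ∑[ j < k ] ∑[ u < n ] coloured j w u    ≡⟨ ∑-comm (λ w j → ∑[ u < n ] coloured j w u) ⟩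
    ∑[ j < k ] ∑[ w < n ] ∑[ u < n ] coloured j w u    ≤⟨ ∑-mono (λ j → ForestBound.forest-edge-min
                                                            (F j) (F-sym j) (F-irrefl j) (F-acyclic j) f) ⟩
    ∑[ j < k ] (2 * ∑[ w < n ] f w)                   ≡⟨ ∑-const k _ ⟩
    k * (2 * ∑[ w < n ] f w)                          ∎
    where
    open ≤-Reasoning
    F : Fin k → Fin n → Fin n → Bool
    F j a b = adj G a b ∧ ⌊ j ≟ c a b ⌋
    coloured : Fin k → Fin n → Fin n → ℕ
    coloured j w u = if F j w u then f w ⊓ f u else 0
    by-colour : ∀ w u → (if adj G w u then f w ⊓ f u else 0) ≡ ∑[ j < k ] coloured j w u
    by-colour w u with adj G w u
    ... | true  = sym (∑-point (c w u) (λ _ → f w ⊓ f u))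
    ... | false = sym (∑-zero k)
    F-sym : ∀ j a b → F j a b ≡ F j b a
    F-sym j a b rewrite Graph.sym G a b with adj G b a in ba
    ... | true  = cong (λ x → ⌊ j ≟ x ⌋) (c-sym a b (trans (Graph.sym G a b) ba))
    ... | false = refl
    F-irrefl : ∀ j a → F j a a ≡ false
    F-irrefl j a rewrite irrefl G a = refl
    F-edge : ∀ j {a b} → F j a b ≡ true → Adj G a b × c a b ≡ j
    F-edge j {a} {b} p with j ≟ c a b
    ... | yes j≡c = ∧-trueˡ p , sym j≡c
    ... | no  _   with ∧-trueʳ {adj G a b} p
    ...   | ()
    F-acyclic : ∀ j → ¬ HasCycle (λ a b → F j a b ≡ true)
    F-acyclic j cycle = c-acyclic j (HasCycle-map (λ {a} {b} → F-edge j {a} {b}) cycle)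

last-occurrence : ∀ {n} (P : Fin n → Bool) →
  (∀ t → P t ≡ false) ⊎ ∃ λ s → P s ≡ true × (∀ t → P t ≡ true → toℕ t ≤ toℕ s)
last-occurrence {zero}  P = inj₁ (λ ())
last-occurrence {suc n} P with last-occurrence (λ t → P (Fin.suc t))
... | inj₂ (s , Ps , last) = inj₂ (Fin.suc s , Ps , shifted)
  where
  shifted : ∀ t → P t ≡ true → toℕ t ≤ suc (toℕ s)
  shifted Fin.zero    _  = z≤n
  shifted (Fin.suc t) Pt = s≤s (last t Pt)
... | inj₁ never-later with P Fin.zero in P0
...   | true  = inj₂ (Fin.zero , P0 , only-zero)
  where
  only-zero : ∀ t → P t ≡ true → toℕ t ≤ 0
  only-zero Fin.zero    _  = z≤n
  only-zero (Fin.suc t) Pt with trans (sym Pt) (never-later t)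
  ... | ()
...   | false = inj₁ never
  where
  never : ∀ t → P t ≡ false
  never Fin.zero    = P0
  never (Fin.suc t) = never-later t

-- Swapping the order
-- of summation, total counts, for each ordered edge (w , u), the times t at
-- which v_t is a neighbour of w and d_{G_t}(w) ≤ d_{G_t}(u).  There are at
-- most d(w) such times (v_t ranges over distinct neighbours of w), and at
-- most d(u): at the last such time s every earlier v_t is a neighbour of w
-- in G_s, so their number is at most d_{G_s}(w) ≤ d_{G_s}(u) ≤ d(u).
module CountingByEdges {n : ℕ} (G : Graph n) (σ : Permutation′ n) where

  v : Fin n → Fin n
  v t = σ ⟨$⟩ʳ t

  degAt : Fin n → Fin n → ℕ
  degAt t y = ∑[ x < n ] 𝟙 (inG G σ t x ∧ adj G y x)

  counted : Fin n → Fin n → Fin n → Bool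
  counted t w u = adj G (v t) w ∧ (deg G σ t w ≤ᵇ deg G σ t u)

  -- Forgetting the conditions that w and u lie in G_t.
  inner≤ : ∀ t → inner G σ t ≤ ∑[ w < n ] ∑[ u < n ] 𝟙 (adj G w u ∧ counted t w u)
  inner≤ t = ≤-trans (≤-reflexive (list-sum-allFin n _)) (∑-mono at)
    where
    at : ∀ w → (if inG G σ t w ∧ adj G (v t) w then h G σ t w else 0)
             ≤ ∑[ u < n ] 𝟙 (adj G w u ∧ counted t w u)
    at w with inG G σ t w ∧ adj G (v t) w in w∈N
    ... | false = z≤n
    ... | true  = ≤-trans (≤-reflexive (list-sum-allFin n _)) (∑-mono drop-inG)
      where
      drop-inG : ∀ u → 𝟙 (inG G σ t u ∧ adj G w u ∧ (deg G σ t w ≤ᵇ deg G σ t u))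
                     ≤ 𝟙 (adj G w u ∧ counted t w u)
      drop-inG u rewrite ∧-trueʳ {inG G σ t w} w∈N = 𝟙-∧ʳ (inG G σ t u) _

  times : Fin n → Fin n → ℕ
  times w u = ∑[ t < n ] 𝟙 (counted t w u)

  -- Distinct times t give distinct neighbours v_t of w.
  times≤degree-w : ∀ w u → times w u ≤ degree G w
  times≤degree-w w u = begin
    times w u                       ≤⟨ ∑-mono neighbour ⟩
    ∑[ t < n ] 𝟙 (adj G w (v t))    ≡⟨ sym (∑-permute (λ x → 𝟙 (adj G w x)) σ) ⟩
    degree G w                      ∎
    where
    open ≤-Reasoning
    neighbour : ∀ t → 𝟙 (counted t w u) ≤ 𝟙 (adj G w (v t))
    neighbour t rewrite Graph.sym G w (v t) = 𝟙-∧ˡ _ _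

  -- Bounded through the degrees in G_s for the last counted time s.
  times≤degree-u : ∀ w u → times w u ≤ degree G u
  times≤degree-u w u with last-occurrence (λ t → counted t w u)
  ... | inj₁ never = ≤-trans (≤-reflexive (trans (sum-cong-≗ (λ t → cong 𝟙 (never t))) (∑-zero n))) z≤n
  ... | inj₂ (s , counted-s , last) = begin
    times w u                                 ≤⟨ ∑-mono before-s ⟩
    ∑[ t < n ] 𝟙 (inG G σ s (v t) ∧ adj G w (v t)) ≡⟨ sym (∑-permute (λ x → 𝟙 (inG G σ s x ∧ adj G w x)) σ) ⟩
    degAt s w                                 ≡⟨ sym (list-sum-allFin n _) ⟩
    deg G σ s w                               ≤⟨ ≤ᵇ⇒≤ (deg G σ s w) (deg G σ s u) (Equivalence.from Bool.T-≡ (∧-trueʳ counted-s)) ⟩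
    deg G σ s u                               ≡⟨ list-sum-allFin n _ ⟩
    degAt s u                                 ≤⟨ ∑-mono (λ x → 𝟙-∧ʳ (inG G σ s x) (adj G u x)) ⟩
    degree G u                                ∎
    where
    open ≤-Reasoning
    -- every counted time t is at most s, so v_t lies in G_s
    before-s : ∀ t → 𝟙 (counted t w u) ≤ 𝟙 (inG G σ s (v t) ∧ adj G w (v t))
    before-s t with counted t w u in counted-t
    ... | false = z≤n
    ... | true rewrite inverseˡ σ {t} | Equivalence.to Bool.T-≡ (≤⇒≤ᵇ (last t counted-t))
                     | Graph.sym G w (v t) = ≤-reflexive (cong 𝟙 (sym (∧-trueˡ counted-t)))

  total≤edgeMin : total G σ ≤ edgeMin G (degree G)
  total≤edgeMin = begin
    total G σ                                                  ≡⟨ list-sum-allFin n _ ⟩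
    ∑[ t < n ] inner G σ t                                     ≤⟨ ∑-mono inner≤ ⟩
    ∑[ t < n ] ∑[ w < n ] ∑[ u < n ] pair t w u                ≡⟨ ∑-comm (λ t w → ∑[ u < n ] pair t w u) ⟩
    ∑[ w < n ] ∑[ t < n ] ∑[ u < n ] pair t w u                ≡⟨ sum-cong-≗ (λ w → ∑-comm (λ t u → pair t w u)) ⟩
    ∑[ w < n ] ∑[ u < n ] ∑[ t < n ] pair t w u                ≤⟨ ∑-mono (λ w → ∑-mono (times≤min w)) ⟩
    edgeMin G (degree G)                                       ∎
    where
    open ≤-Reasoning
    pair : Fin n → Fin n → Fin n → ℕ
    pair t w u = 𝟙 (adj G w u ∧ counted t w u)
    times≤min : ∀ w u → ∑[ t < n ] pair t w u ≤ (if adj G w u then degree G w ⊓ degree G u else 0)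
    times≤min w u with adj G w u
    ... | true  = ⊓-glb (times≤degree-w w u) (times≤degree-u w u)
    ... | false = ≤-reflexive (∑-zero n)

-- Corollary 1: total ≤ 8 α(G) m (the argument gives 4 α(G) m).
corollary1 : (n : ℕ) (G : Graph n) (σ : Permutation′ n) (k : ℕ) →
    IsArboricity G k → total G σ ≤ 8 * k * edges G
corollary1 n G σ k (forests , _) = begin
  total G σ                                    ≤⟨ CountingByEdges.total≤edgeMin G σ ⟩
  edgeMin G (degree G)                         ≤⟨ edgeMin-forests G k forests (degree G) ⟩
  k * (2 * ∑[ y < n ] degree G y)              ≤⟨ *-monoʳ-≤ k (*-monoʳ-≤ 2 (handshake G)) ⟩
  k * (2 * (2 * edges G))                      ≤⟨ *-monoʳ-≤ k 4m≤8m ⟩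
  k * (8 * edges G)                            ≡⟨ sym (*-assoc k 8 (edges G)) ⟩
  k * 8 * edges G                              ≡⟨ cong (_* edges G) (*-comm k 8) ⟩
  8 * k * edges G                              ∎
  where
  open ≤-Reasoning
  4m≤8m : 2 * (2 * edges G) ≤ 8 * edges G
  4m≤8m = ≤-trans (≤-reflexive (sym (*-assoc 2 2 (edges G)))) (*-monoˡ-≤ (edges G) (m≤m+n 4 4))
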